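{- For all integers $n\geq 1$, $\overline{C}_{4,1}(n)\equiv 1\pmod 2$ if $n=k(3k-1)$ for some integer $k$, and $\overline{C}_{4,1}(n)\equiv 0\pmod 2$ otherwise.
   Context: An overpartition of $n$ is a partition of $n$ in which the first occurrence of each distinct part may optionally be overlined. $\overline{C}_{4,1}(n)$ denotes the number of overpartitions of $n$ in which no part is divisible by $4$ and only parts congruent to $\pm 1 \pmod{4}$ may be overlined; equivalently $\sum_{n\ge0}\overline{C}_{4,1}(n)q^n=\frac{(q^4;q^4)_\infty(-q;q^4)_\infty(-q^3;q^4)_\infty}{(q;q)_\infty}$, where $(A;q)_\infty=\prod_{j\ge0}(1-Aq^j)$. -}

module Defs where

open import Data.Nat using (ℕ; zero; suc; _+_; _*_; _∸_; _≤?_; _%_)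
open import Data.Bool using (Bool; true; false)
open import Data.Product using (_×_; _,_)
open import Data.List using (List; []; _∷_; _++_; concatMap; map; replicate; upTo; length; filterᵇ)
open import Relation.Nullary.Decidable using (⌊_⌋)

-- An overpartition is represented as a list of parts, each part being a pair
-- (size , overlined?).  Parts are listed in decreasing order of size, and for each
-- distinct size s occurring with multiplicity m ≥ 1 the block is
--   (s , b) ∷ replicate (m ∸ 1) (s , false)
-- i.e. only the first occurrence of a size may be overlined.
Part : Set
Part = ℕ × Bool

-- allowed overline flags for a part of size s in C̄_{4,1}:
-- only parts ≡ ±1 (mod 4), i.e. odd parts, may be overlined
flags : ℕ → List Bool
flags s with s % 2
... | 1 = false ∷ true ∷ []
... | _ = false ∷ []

blocks : ℕ → ℕ → List (List Part)
blocks s zero    = [] ∷ []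
blocks s (suc m) = map (λ b → (s , b) ∷ replicate m (s , false)) (flags s)

-- ops s n : the list of all overpartitions of n with all parts ≤ s,
-- no part divisible by 4, and only parts ≡ ±1 (mod 4) possibly overlined
ops : ℕ → ℕ → List (List Part)
ops zero zero    = [] ∷ []
ops zero (suc n) = []
ops (suc s) n with (suc s) % 4
... | zero  = ops s n
... | suc _ =
  concatMap
    (λ m → concatMap (λ blk → map (blk ++_) (ops s (n ∸ m * suc s))) (blocks (suc s) m))
    (filterᵇ (λ m → ⌊ m * suc s ≤? n ⌋) (upTo (suc n)))

C41 : ℕ → ℕ
C41 n = length (ops n n)

module Submission where

-- We compute modulo 2 with power series over GF(2), represented as coefficient
-- functions ℕ → Bool, and only ever multiply by binomials 1 + q^x.  Three facts
-- are proved and then combined: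
--
--  (a) Generating function.  Modulo 2 odd parts contribute nothing (each
--      positive multiplicity comes with and without an overline), parts divisible
--      by 4 are excluded, and each part x ≡ 2 (mod 4) contributes 1/(1 - q^x).
--      Hence  ∏_{j odd} (1 + q^{2j}) · Σ_n C̄_{4,1}(n) q^n ≡ 1  (parityC-inverse).
--  (b) Euler's odd/distinct identity mod 2:  ∏_{j odd} (1 + q^{2j}) ∏_j (1 + q^{2j}) ≡ 1,
--      proved by splitting off even indices and squaring (odd-times-every).
--  (c) Euler's pentagonal number theorem mod 2:  ∏_j (1 + q^{2j}) ≡ Σ_k q^{k(3k-1)},
--      proved for finite products by a telescoping sum (block≈pentSum).
--
-- Cancelling the invertible product of (a) and (b) gives Σ C̄_{4,1}(n) q^n ≡ Σ_k q^{k(3k-1)},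
-- and all identities are tracked up to the degree n in question.

open import Algebra.Bundles using (CommutativeRing)
open import Data.Bool using (Bool; true; false; not; _xor_; _∧_; if_then_else_)
open import Data.Bool.Properties
  using (xor-same; xor-assoc; xor-comm; xor-identityʳ; ∧-zeroʳ; xor-∧-commutativeRing; ¬-not)
open import Data.Empty using (⊥-elim)
open import Data.Integer as ℤ using (ℤ; +_; -[1+_])
import Data.Integer.Properties as ℤ
import Data.Integer.Tactic.RingSolver as ℤSolver
open import Data.List using (List; []; _∷_; _++_; concatMap; map; applyUpTo; length; filterᵇ)
open import Data.List.Properties using (length-++; length-map; map-cong)
open import Data.Nat
  using (ℕ; zero; suc; _+_; _*_; _∸_; _^_; _≤_; _<_; z≤n; s≤s; _≤?_; _<?_; _%_; ⌊_/2⌋; NonZero)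
open import Data.Nat.DivMod using ([m+n]%n≡m%n)
open import Data.Nat.Properties
open import Data.Nat.Tactic.RingSolver using (solve-∀)
open import Data.Product using (∃-syntax; _×_; _,_; proj₁; proj₂)
open import Data.Sum using (_⊎_; inj₁; inj₂)
open import Function.Base using (_∘_; _$_)
open import Function.Bundles using (mk⇔)
open import Relation.Nullary using (¬_; yes; no)
open import Relation.Nullary.Decidable using (⌊_⌋; dec-false; does-⇔; isYes≗does)
open import Relation.Binary.PropositionalEquality
open import Algebra.Properties.CommutativeSemigroup
  (CommutativeRing.+-commutativeSemigroup xor-∧-commutativeRing)
  using (interchange; xy∙z≈zx∙y; xy∙z≈xz∙y)

open import Defs

xor-unpadʳ : ∀ a c → (a xor c) xor c ≡ a
xor-unpadʳ a c = trans (xor-assoc a c c) (trans (cong (a xor_) (xor-same c)) (xor-identityʳ a))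

xor-cancel-middle : ∀ a b c → (a xor b) xor (b xor c) ≡ a xor c
xor-cancel-middle a b c =
  trans (xor-assoc a b (b xor c))
        (cong (a xor_) (trans (sym (xor-assoc b b c)) (cong (_xor c) (xor-same b))))

xor-cancelʳ : ∀ a b c → a xor c ≡ b xor c → a ≡ b
xor-cancelʳ a b c eq = trans (sym (xor-unpadʳ a c)) (trans (cong (_xor c) eq) (xor-unpadʳ b c))

xor-true : ∀ a b → a xor b ≡ true → a ≡ true ⊎ b ≡ true
xor-true true  b eq = inj₁ refl
xor-true false b eq = inj₂ eq

isOdd : ℕ → Bool
isOdd zero          = false
isOdd (suc zero)    = true
isOdd (suc (suc n)) = isOdd n

isOdd-suc : ∀ n → isOdd (suc n) ≡ not (isOdd n)
isOdd-suc zero          = refl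
isOdd-suc (suc zero)    = refl
isOdd-suc (suc (suc n)) = isOdd-suc n

isOdd-+ : ∀ a b → isOdd (a + b) ≡ isOdd a xor isOdd b
isOdd-+ zero          b = refl
isOdd-+ (suc zero)    b = isOdd-suc b
isOdd-+ (suc (suc a)) b = isOdd-+ a b

%-period : ∀ d k .{{_ : NonZero d}} → (d + k) % d ≡ k % d
%-period d k = trans (cong (_% d) (+-comm d k)) ([m+n]%n≡m%n k d)

bit : Bool → ℕ
bit false = 0
bit true  = 1

isOdd-%2 : ∀ m → m % 2 ≡ bit (isOdd m)
isOdd-%2 zero          = refl
isOdd-%2 (suc zero)    = refl
isOdd-%2 (suc (suc m)) = trans (%-period 2 m) (isOdd-%2 m)

-- A power series over GF(2) is its coefficient function.  The only products we
-- need are by monomials q^x and by binomials 1 + q^x.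
Series : Set
Series = ℕ → Bool

infixl 6 _⊕_
_⊕_ : Series → Series → Series
(f ⊕ g) n = f n xor g n

one : Series
one zero    = true
one (suc n) = false

shift : ℕ → Series → Series
shift zero    f         = f
shift (suc x) f zero    = false
shift (suc x) f (suc n) = shift x f n

binom : ℕ → Series → Series
binom x f = f ⊕ shift x f

mono : ℕ → Series
mono x = shift x one

_≈[_]_ : Series → ℕ → Series → Set
f ≈[ N ] g = ∀ n → n ≤ N → f n ≡ g n

≈-sym : ∀ {f g N} → f ≈[ N ] g → g ≈[ N ] f
≈-sym f≈g n n≤N = sym (f≈g n n≤N)

≈-trans : ∀ {f g h N} → f ≈[ N ] g → g ≈[ N ] h → f ≈[ N ] h
≈-trans f≈g g≈h n n≤N = trans (f≈g n n≤N) (g≈h n n≤N)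

≗⇒≈ : ∀ {f g} N → f ≗ g → f ≈[ N ] g
≗⇒≈ N f≗g n _ = f≗g n

shift-by : ∀ {a b} f → a ≡ b → shift a f ≗ shift b f
shift-by f refl n = refl

shift-cong : ∀ x {f g} → f ≗ g → shift x f ≗ shift x g
shift-cong zero    f≗g n       = f≗g n
shift-cong (suc x) f≗g zero    = refl
shift-cong (suc x) f≗g (suc n) = shift-cong x f≗g n

shift-⊕ : ∀ x f g → shift x (f ⊕ g) ≗ shift x f ⊕ shift x g
shift-⊕ zero    f g n       = refl
shift-⊕ (suc x) f g zero    = refl
shift-⊕ (suc x) f g (suc n) = shift-⊕ x f g n

shift-+ : ∀ a b f → shift a (shift b f) ≗ shift (a + b) f
shift-+ zero    b f n       = refl
shift-+ (suc a) b f zero    = refl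
shift-+ (suc a) b f (suc n) = shift-+ a b f n

shift-comm : ∀ a b f → shift a (shift b f) ≗ shift b (shift a f)
shift-comm a b f n =
  trans (shift-+ a b f n) (trans (shift-by f (+-comm a b) n) (sym (shift-+ b a f n)))

shift-local : ∀ x {f g} n → (∀ m → m ≤ n → f m ≡ g m) → shift x f n ≡ shift x g n
shift-local zero    n       f=g = f=g n ≤-refl
shift-local (suc x) zero    f=g = refl
shift-local (suc x) (suc n) f=g = shift-local x n (λ m m≤n → f=g m (m≤n⇒m≤1+n m≤n))

shift-local< : ∀ x {f g} n → (∀ m → m < n → f m ≡ g m) → shift (suc x) f n ≡ shift (suc x) g n
shift-local< x zero    f=g = refl
shift-local< x (suc n) f=g = shift-local x n (λ m m≤n → f=g m (s≤s m≤n))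

shift-below : ∀ x f n → n < x → shift x f n ≡ false
shift-below (suc x) f zero    _         = refl
shift-below (suc x) f (suc n) (s≤s n<x) = shift-below x f n n<x

shift-at : ∀ x f r → shift x f (x + r) ≡ f r
shift-at zero    f r = refl
shift-at (suc x) f r = shift-at x f r

shift-null : ∀ x g → (∀ n → g n ≡ false) → ∀ n → shift x g n ≡ false
shift-null zero    g g=0 n       = g=0 n
shift-null (suc x) g g=0 zero    = refl
shift-null (suc x) g g=0 (suc n) = shift-null x g g=0 n

mono-at : ∀ x → mono x x ≡ true
mono-at zero    = refl
mono-at (suc x) = mono-at x

mono-off : ∀ x m → m ≢ x → mono x m ≡ false
mono-off zero    zero    m≢x = ⊥-elim (m≢x refl)
mono-off zero    (suc m) m≢x = refl
mono-off (suc x) zero    m≢x = refl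
mono-off (suc x) (suc m) m≢x = mono-off x m (m≢x ∘ cong suc)

mono-true : ∀ x m → mono x m ≡ true → m ≡ x
mono-true zero    zero    eq = refl
mono-true (suc x) (suc m) eq = cong suc (mono-true x m eq)

binom-cong : ∀ x {f g} → f ≗ g → binom x f ≗ binom x g
binom-cong x f≗g n = cong₂ _xor_ (f≗g n) (shift-cong x f≗g n)

binom-comm : ∀ a b f → binom a (binom b f) ≗ binom b (binom a f)
binom-comm a b f n = begin
  (f n xor shift b f n) xor shift a (f ⊕ shift b f) n
    ≡⟨ cong ((f n xor shift b f n) xor_) (shift-⊕ a f (shift b f) n) ⟩
  (f n xor shift b f n) xor (shift a f n xor shift a (shift b f) n)
    ≡⟨ interchange (f n) (shift b f n) (shift a f n) (shift a (shift b f) n) ⟩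
  (f n xor shift a f n) xor (shift b f n xor shift a (shift b f) n)
    ≡⟨ cong (λ z → (f n xor shift a f n) xor (shift b f n xor z)) (shift-comm a b f n) ⟩
  (f n xor shift a f n) xor (shift b f n xor shift b (shift a f) n)
    ≡⟨ cong ((f n xor shift a f n) xor_) (sym (shift-⊕ b f (shift a f) n)) ⟩
  (f n xor shift a f n) xor shift b (f ⊕ shift a f) n
    ∎
  where open ≡-Reasoning

binom-square : ∀ x f → binom x (binom x f) ≗ binom (x + x) f
binom-square x f n = begin
  (f n xor shift x f n) xor shift x (f ⊕ shift x f) n
    ≡⟨ cong ((f n xor shift x f n) xor_) (shift-⊕ x f (shift x f) n) ⟩
  (f n xor shift x f n) xor (shift x f n xor shift x (shift x f) n)
    ≡⟨ xor-cancel-middle (f n) (shift x f n) (shift x (shift x f) n) ⟩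
  f n xor shift x (shift x f) n
    ≡⟨ cong (f n xor_) (shift-+ x x f n) ⟩
  f n xor shift (x + x) f n
    ∎
  where open ≡-Reasoning

binom-local : ∀ x {f g} N → f ≈[ N ] g → binom x f ≈[ N ] binom x g
binom-local x N f≈g n n≤N =
  cong₂ _xor_ (f≈g n n≤N) (shift-local x n (λ m m≤n → f≈g m (≤-trans m≤n n≤N)))

binom-high : ∀ x f N → N < x → binom x f ≈[ N ] f
binom-high x f N N<x n n≤N =
  trans (cong (f n xor_) (shift-below x f n (≤-<-trans n≤N N<x))) (xor-identityʳ (f n))

-- 1 + q^x (x ≥ 1) is invertible, so multiplication by it can be cancelled
-- degree by degree.
binom-cancel : ∀ x {f g} N → binom (suc x) f ≈[ N ] binom (suc x) g → f ≈[ N ] g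
binom-cancel x {f} {g} N eq = agreeUpTo N ≤-refl
  where
  agreeUpTo : ∀ K → K ≤ N → f ≈[ K ] g
  agreeUpTo zero    K≤N .zero z≤n = xor-cancelʳ (f 0) (g 0) false (eq 0 K≤N)
  agreeUpTo (suc K) K≤N n   n≤K with m≤n⇒m<n∨m≡n n≤K
  ... | inj₁ (s≤s n≤K) = agreeUpTo K (≤-trans (n≤1+n K) K≤N) n n≤K
  ... | inj₂ refl = xor-cancelʳ (f n) (g n) (shift (suc x) f n)
        (trans (eq n K≤N)
               (cong (g n xor_) (sym (shift-local< x n
                 (λ m m<n → agreeUpTo K (≤-trans (n≤1+n K) K≤N) m (≤-pred m<n))))))

prod : ℕ → (ℕ → Bool) → ℕ → Series → Series
prod t sel zero    f = f
prod t sel (suc K) f = if sel (suc K) then binom (t * suc K) (prod t sel K f) else prod t sel K f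

every : ℕ → Bool
every _ = true

prod-skip : ∀ t sel K f → sel (suc K) ≡ false → prod t sel (suc K) f ≡ prod t sel K f
prod-skip t sel K f eq rewrite eq = refl

prod-take : ∀ t sel K f → sel (suc K) ≡ true → prod t sel (suc K) f ≡ binom (t * suc K) (prod t sel K f)
prod-take t sel K f eq rewrite eq = refl

prod-cong : ∀ t sel K {f g} → f ≗ g → prod t sel K f ≗ prod t sel K g
prod-cong t sel zero    f≗g = f≗g
prod-cong t sel (suc K) f≗g with sel (suc K)
... | true  = binom-cong (t * suc K) (prod-cong t sel K f≗g)
... | false = prod-cong t sel K f≗g

prod-local : ∀ t sel K {f g} N → f ≈[ N ] g → prod t sel K f ≈[ N ] prod t sel K g
prod-local t sel zero    N f≈g = f≈g
prod-local t sel (suc K) N f≈g with sel (suc K)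
... | true  = binom-local (t * suc K) N (prod-local t sel K N f≈g)
... | false = prod-local t sel K N f≈g

binom-prod : ∀ x t sel K f → binom x (prod t sel K f) ≗ prod t sel K (binom x f)
binom-prod x t sel zero    f n = refl
binom-prod x t sel (suc K) f with sel (suc K)
... | true  = λ n → trans (binom-comm x (t * suc K) (prod t sel K f) n)
                          (binom-cong (t * suc K) (binom-prod x t sel K f) n)
... | false = binom-prod x t sel K f

prod-comm : ∀ t sel K t′ sel′ K′ f →
            prod t sel K (prod t′ sel′ K′ f) ≗ prod t′ sel′ K′ (prod t sel K f)
prod-comm t sel zero    t′ sel′ K′ f n = refl
prod-comm t sel (suc K) t′ sel′ K′ f with sel (suc K)
... | true  = λ n → trans (binom-cong (t * suc K) (prod-comm t sel K t′ sel′ K′ f) n)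
                          (binom-prod (t * suc K) t′ sel′ K′ (prod t sel K f) n)
... | false = prod-comm t sel K t′ sel′ K′ f

prod-tail : ∀ t sel N g K d → N < t * suc K → prod t sel (d + K) g ≈[ N ] prod t sel K g
prod-tail t sel N g K zero    N<t[1+K] = λ n _ → refl
prod-tail t sel N g K (suc d) N<t[1+K] with sel (suc (d + K))
... | true  = ≈-trans (binom-high (t * suc (d + K)) (prod t sel (d + K) g) N
                         (<-≤-trans N<t[1+K] (*-monoʳ-≤ t (s≤s (m≤n+m K d)))))
                      (prod-tail t sel N g K d N<t[1+K])
... | false = prod-tail t sel N g K d N<t[1+K]

prod-trim : ∀ t sel N g {K K′} → K′ ≤ K → N < t * suc K′ → prod t sel K g ≈[ N ] prod t sel K′ g
prod-trim t sel N g {K} {K′} K′≤K N<t[1+K′] =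
  subst (λ z → prod t sel z g ≈[ N ] prod t sel K′ g) (m∸n+n≡m K′≤K) (prod-tail t sel N g K′ (K ∸ K′) N<t[1+K′])

prod-cancel : ∀ t sel K {f g} N → prod (suc t) sel K f ≈[ N ] prod (suc t) sel K g → f ≈[ N ] g
prod-cancel t sel zero    N eq = eq
prod-cancel t sel (suc K) N eq with sel (suc K)
... | true  = prod-cancel t sel K N (binom-cancel (K + t * suc K) N eq)
... | false = prod-cancel t sel K N eq

-- Splitting the indices j ≤ K into odd ones and the doubles of
-- those ≤ ⌊K/2⌋ needs the following facts about halving.
half-odd : ∀ K → isOdd (suc K) ≡ true → ⌊ suc K /2⌋ ≡ ⌊ K /2⌋
half-odd zero          eq = refl
half-odd (suc (suc K)) eq = cong suc (half-odd K eq)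

half-even : ∀ K → isOdd (suc K) ≡ false →
            ⌊ suc K /2⌋ ≡ suc ⌊ K /2⌋ × suc K ≡ suc ⌊ K /2⌋ + suc ⌊ K /2⌋
half-even (suc zero)    eq = refl , refl
half-even (suc (suc K)) eq with half-even K eq
... | h≡ , K≡ = cong suc h≡ , cong (suc ∘ suc) (trans K≡ (sym (+-suc ⌊ K /2⌋ (suc ⌊ K /2⌋))))

half-bound : ∀ K → K ≤ suc (⌊ K /2⌋ + ⌊ K /2⌋)
half-bound zero          = z≤n
half-bound (suc zero)    = s≤s z≤n
half-bound (suc (suc K)) =
  s≤s (≤-trans (s≤s (half-bound K)) (≤-reflexive (cong suc (sym (+-suc ⌊ K /2⌋ ⌊ K /2⌋)))))

-- Squaring the odd-index product doubles its scale (Frobenius, factor by factor).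
odd-product-square : ∀ t K f → prod t isOdd K (prod t isOdd K f) ≗ prod (t + t) isOdd K f
odd-product-square t zero    f n = refl
odd-product-square t (suc K) f with isOdd (suc K)
... | false = odd-product-square t K f
... | true  = λ n → begin
    binom x (prod t isOdd K (binom x (prod t isOdd K f))) n
      ≡⟨ binom-cong x (λ m → sym (binom-prod x t isOdd K (prod t isOdd K f) m)) n ⟩
    binom x (binom x (prod t isOdd K (prod t isOdd K f))) n
      ≡⟨ binom-square x (prod t isOdd K (prod t isOdd K f)) n ⟩
    binom (x + x) (prod t isOdd K (prod t isOdd K f)) n
      ≡⟨ binom-cong (x + x) (odd-product-square t K f) n ⟩
    binom (x + x) (prod (t + t) isOdd K f) n
      ≡⟨ cong (λ z → binom z (prod (t + t) isOdd K f) n) (sym (*-distribʳ-+ (suc K) t t)) ⟩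
    binom ((t + t) * suc K) (prod (t + t) isOdd K f) n
      ∎
  where
  open ≡-Reasoning
  x : ℕ
  x = t * suc K

every-split : ∀ t K f → prod t every K f ≗ prod (t + t) every ⌊ K /2⌋ (prod t isOdd K f)
every-split t zero    f n = refl
every-split t (suc K) f with isOdd (suc K) in odd
... | true = λ n →
  trans (binom-cong (t * suc K) (every-split t K f) n)
        (trans (binom-prod (t * suc K) (t + t) every ⌊ K /2⌋ (prod t isOdd K f) n)
               (cong (λ h → prod (t + t) every h (binom (t * suc K) (prod t isOdd K f)) n)
                     (sym (half-odd K odd))))
... | false with half-even K odd
...   | h≡ , K≡ = λ n →
  trans (binom-cong (t * suc K) (every-split t K f) n)
        (trans (cong (λ z → binom z (prod (t + t) every ⌊ K /2⌋ (prod t isOdd K f)) n) degree)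
               (cong (λ h → prod (t + t) every h (prod t isOdd K f) n) (sym h≡)))
  where
  degree : t * suc K ≡ (t + t) * suc ⌊ K /2⌋
  degree = trans (cong (t *_) K≡)
                 (trans (*-distribˡ-+ t (suc ⌊ K /2⌋) (suc ⌊ K /2⌋))
                        (sym (*-distribʳ-+ (suc ⌊ K /2⌋) t t)))

-- The identity, up to degree N, for any scale t and length K covering degree N.
-- Induction on F (with N < 2^F t): splitting and squaring doubles the scale t.
odd-times-every : ∀ F t K N → N < 2 ^ F * t → N < t * suc K →
                  prod t isOdd K (prod t every K one) ≈[ N ] one
odd-times-every zero t K N N<t N<t[1+K] =
  ≈-trans (prod-trim t isOdd N (prod t every K one) {K} z≤n N<t*1) (prod-trim t every N one {K} z≤n N<t*1)
  where
  N<t*1 : N < t * 1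
  N<t*1 = subst (N <_) (trans (+-identityʳ t) (sym (*-identityʳ t))) N<t
odd-times-every (suc F) t K N N<2^F*2t N<t[1+K] =
  ≈-trans (≗⇒≈ N regroup)
  (≈-trans (prod-local (t + t) every h N (prod-trim (t + t) isOdd N one (⌊n/2⌋≤n K) N<2t[1+h]))
  (≈-trans (≗⇒≈ N (prod-comm (t + t) every h (t + t) isOdd h one))
           (odd-times-every F (t + t) h N (subst (N <_) (scale (2 ^ F) t) N<2^F*2t) N<2t[1+h])))
  where
  h : ℕ
  h = ⌊ K /2⌋
  -- odd_t(K) · every_t(K) = odd_t(K) · every_{2t}(h) · odd_t(K) = every_{2t}(h) · odd_{2t}(K)
  regroup : prod t isOdd K (prod t every K one) ≗ prod (t + t) every h (prod (t + t) isOdd K one)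
  regroup n = trans (prod-cong t isOdd K (every-split t K one) n)
                    (trans (prod-comm t isOdd K (t + t) every h (prod t isOdd K one) n)
                           (prod-cong (t + t) every h (odd-product-square t K one) n))
  halve : ∀ t h → t * suc (suc (h + h)) ≡ (t + t) * suc h
  halve = solve-∀
  N<2t[1+h] : N < (t + t) * suc h
  N<2t[1+h] = <-≤-trans N<t[1+K] (≤-trans (*-monoʳ-≤ t (s≤s (half-bound K))) (≤-reflexive (halve t h)))
  scale : ∀ a t → (2 * a) * t ≡ a * (t + t)
  scale = solve-∀

-- The generalised pentagonal numbers k(3k - 1) for k = i + 1 and k = -(i + 1).
pent⁺ pent⁻ : ℕ → ℕ
pent⁺ i = suc i * (3 * i + 2)
pent⁻ i = suc i * (3 * i + 4)

pentPair : ℕ → Series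
pentPair i = mono (pent⁺ i) ⊕ mono (pent⁻ i)

pentSum : ℕ → Series
pentSum zero    = one
pentSum (suc n) = pentSum n ⊕ pentPair n

block : ℕ → ℕ → Series
block k zero    = one
block k (suc d) = binom (2 * (k + suc d)) (block k d)

block-peel : ∀ k d → block k (suc d) ≗ binom (2 * suc k) (block (suc k) d)
block-peel k zero    n = cong (λ z → binom (2 * z) one n) (+-comm k 1)
block-peel k (suc d) n = begin
  binom (2 * (k + suc (suc d))) (block k (suc d)) n
    ≡⟨ binom-cong (2 * (k + suc (suc d))) (block-peel k d) n ⟩
  binom (2 * (k + suc (suc d))) (binom (2 * suc k) (block (suc k) d)) n
    ≡⟨ binom-comm (2 * (k + suc (suc d))) (2 * suc k) (block (suc k) d) n ⟩
  binom (2 * suc k) (binom (2 * (k + suc (suc d))) (block (suc k) d)) n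
    ≡⟨ cong (λ z → binom (2 * suc k) (binom (2 * z) (block (suc k) d)) n) (+-suc k (suc d)) ⟩
  binom (2 * suc k) (binom (2 * (suc k + suc d)) (block (suc k) d)) n
    ∎
  where open ≡-Reasoning

block-prod : ∀ K → block 0 K ≗ prod 2 every K one
block-prod zero    n = refl
block-prod (suc K) = binom-cong (2 * suc K) (block-prod K)

-- Consecutive terms differ by
-- lowPart + highPart, the high part of one step cancels the low part of the next,
-- and what survives are the pentagonal pairs.
offset : ℕ → ℕ → ℕ
offset k d = k * suc k + 2 * (k + d) * k

term : ℕ → ℕ → Series
term k d = shift (offset k d) (block k d)

lowPart : ℕ → ℕ → Series
lowPart k d = shift (offset k d) (binom (2 * k) (block k d))

highPart : ℕ → ℕ → Series
highPart k d = shift (offset k d + 2 * k + 2 * (k + d) + 2) (block k d)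

telescope : ℕ → ℕ → Series
telescope k zero    = term k zero
telescope k (suc d) = term k (suc d) ⊕ telescope (suc k) d

term-step : ∀ k d → term k (suc d) ⊕ term k d ≗ lowPart k d ⊕ highPart k d
term-step k d n = begin
  shift E₁ (B ⊕ shift x B) n xor shift E B n
    ≡⟨ cong (_xor shift E B n) (shift-⊕ E₁ B (shift x B) n) ⟩
  (shift E₁ B n xor shift E₁ (shift x B) n) xor shift E B n
    ≡⟨ cong (λ z → (z xor shift E₁ (shift x B) n) xor shift E B n) (shift-by B (low k d) n) ⟩
  (shift (E + 2 * k) B n xor shift E₁ (shift x B) n) xor shift E B n
    ≡⟨ cong (λ z → (shift (E + 2 * k) B n xor z) xor shift E B n)
            (trans (shift-+ E₁ x B n) (shift-by B (high k d) n)) ⟩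
  (shift (E + 2 * k) B n xor highPart k d n) xor shift E B n
    ≡⟨ xy∙z≈zx∙y (shift (E + 2 * k) B n) (highPart k d n) (shift E B n) ⟩
  (shift E B n xor shift (E + 2 * k) B n) xor highPart k d n
    ≡⟨ cong (_xor highPart k d n)
            (sym (trans (shift-⊕ E B (shift (2 * k) B) n) (cong (shift E B n xor_) (shift-+ E (2 * k) B n)))) ⟩
  lowPart k d n xor highPart k d n
    ∎
  where
  open ≡-Reasoning
  B : Series
  B = block k d
  x : ℕ
  x = 2 * (k + suc d)
  E : ℕ
  E = offset k d
  E₁ : ℕ
  E₁ = offset k (suc d)
  low : ∀ k d → k * suc k + 2 * (k + suc d) * k ≡ k * suc k + 2 * (k + d) * k + 2 * k
  low = solve-∀
  high : ∀ k d → k * suc k + 2 * (k + suc d) * k + 2 * (k + suc d)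
                 ≡ k * suc k + 2 * (k + d) * k + 2 * k + 2 * (k + d) + 2
  high = solve-∀

highPart-cancels : ∀ k d → highPart k (suc d) ≗ lowPart (suc k) d
highPart-cancels k d n =
  trans (shift-cong (offset k (suc d) + 2 * k + 2 * (k + suc d) + 2) (block-peel k d) n)
        (shift-by (binom (2 * suc k) (block (suc k) d)) (exponent k d) n)
  where
  exponent : ∀ k d → k * suc k + 2 * (k + suc d) * k + 2 * k + 2 * (k + suc d) + 2
                     ≡ suc k * suc (suc k) + 2 * (suc k + d) * suc k
  exponent = solve-∀

highPart-survives : ∀ k → highPart k 0 ⊕ term (suc k) 0 ≗ pentPair k
highPart-survives k n = cong₂ _xor_ (shift-by one (plus k) n) (shift-by one (minus k) n)
  where
  plus : ∀ k → k * suc k + 2 * (k + 0) * k + 2 * k + 2 * (k + 0) + 2 ≡ suc k * (3 * k + 2)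
  plus = solve-∀
  minus : ∀ k → suc k * suc (suc k) + 2 * (suc k + 0) * suc k ≡ suc k * (3 * k + 4)
  minus = solve-∀

-- At k = 0 the low part is q^0 (1 + q^0) · block = 0.
lowPart-vanishes : ∀ d n → lowPart 0 d n ≡ false
lowPart-vanishes d = shift-null (offset 0 d) (binom 0 (block 0 d)) (λ m → xor-same (block 0 d m))

telescope-step : ∀ k d → telescope k (suc d) ⊕ telescope k d ≗ lowPart k d ⊕ pentPair (k + d)
telescope-step k zero n = begin
  (term k 1 n xor term (suc k) 0 n) xor term k 0 n
    ≡⟨ xy∙z≈xz∙y (term k 1 n) (term (suc k) 0 n) (term k 0 n) ⟩
  (term k 1 n xor term k 0 n) xor term (suc k) 0 n
    ≡⟨ cong (_xor term (suc k) 0 n) (term-step k 0 n) ⟩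
  (lowPart k 0 n xor highPart k 0 n) xor term (suc k) 0 n
    ≡⟨ xor-assoc (lowPart k 0 n) (highPart k 0 n) (term (suc k) 0 n) ⟩
  lowPart k 0 n xor (highPart k 0 n xor term (suc k) 0 n)
    ≡⟨ cong (lowPart k 0 n xor_) (trans (highPart-survives k n) (cong (λ z → pentPair z n) (sym (+-identityʳ k)))) ⟩
  lowPart k 0 n xor pentPair (k + 0) n
    ∎
  where open ≡-Reasoning
telescope-step k (suc d) n = begin
  (term k (2 + d) n xor telescope (suc k) (suc d) n) xor (term k (suc d) n xor telescope (suc k) d n)
    ≡⟨ interchange (term k (2 + d) n) (telescope (suc k) (suc d) n) (term k (suc d) n) (telescope (suc k) d n) ⟩
  (term k (2 + d) n xor term k (suc d) n) xor (telescope (suc k) (suc d) n xor telescope (suc k) d n)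
    ≡⟨ cong₂ _xor_ (term-step k (suc d) n) (telescope-step (suc k) d n) ⟩
  (lowPart k (suc d) n xor highPart k (suc d) n) xor (lowPart (suc k) d n xor pentPair (suc k + d) n)
    ≡⟨ cong (λ z → (lowPart k (suc d) n xor z) xor (lowPart (suc k) d n xor pentPair (suc k + d) n))
            (highPart-cancels k d n) ⟩
  (lowPart k (suc d) n xor lowPart (suc k) d n) xor (lowPart (suc k) d n xor pentPair (suc k + d) n)
    ≡⟨ xor-cancel-middle (lowPart k (suc d) n) (lowPart (suc k) d n) (pentPair (suc k + d) n) ⟩
  lowPart k (suc d) n xor pentPair (suc k + d) n
    ≡⟨ cong (λ z → lowPart k (suc d) n xor pentPair z n) (sym (+-suc k d)) ⟩
  lowPart k (suc d) n xor pentPair (k + suc d) n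
    ∎
  where open ≡-Reasoning

telescope≗pentSum : ∀ n → telescope 0 n ≗ pentSum n
telescope≗pentSum zero    m = refl
telescope≗pentSum (suc n) m = begin
  telescope 0 (suc n) m
    ≡⟨ sym (xor-unpadʳ (telescope 0 (suc n) m) (telescope 0 n m)) ⟩
  (telescope 0 (suc n) m xor telescope 0 n m) xor telescope 0 n m
    ≡⟨ cong₂ _xor_ (telescope-step 0 n m) (telescope≗pentSum n m) ⟩
  (lowPart 0 n m xor pentPair n m) xor pentSum n m
    ≡⟨ cong (λ z → (z xor pentPair n m) xor pentSum n m) (lowPart-vanishes n m) ⟩
  pentPair n m xor pentSum n m
    ≡⟨ xor-comm (pentPair n m) (pentSum n m) ⟩
  pentSum (suc n) m
    ∎
  where open ≡-Reasoning

term-beyond : ∀ k d m → m ≤ suc k + d → term (suc k) d m ≡ false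
term-beyond k d m m≤ = shift-below (offset (suc k) d) (block (suc k) d) m
  (≤-<-trans m≤ (≤-trans (m≤m+n (suc (suc k + d)) excess) (≤-reflexive (expand k d))))
  where
  excess : ℕ
  excess = k * k + 4 * k + 2 + d + 2 * (1 + k + d) * k
  expand : ∀ k d → suc (suc k + d) + (k * k + 4 * k + 2 + d + 2 * (1 + k + d) * k)
                   ≡ suc k * suc (suc k) + 2 * (suc k + d) * suc k
  expand = solve-∀

telescope-beyond : ∀ k d m → m ≤ suc k + d → telescope (suc k) d m ≡ false
telescope-beyond k zero    m m≤ = term-beyond k zero m m≤
telescope-beyond k (suc d) m m≤ =
  cong₂ _xor_ (term-beyond k (suc d) m m≤)
              (telescope-beyond (suc k) d m (≤-trans m≤ (≤-reflexive (+-suc (suc k) d))))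

block≈pentSum : ∀ n → block 0 n ≈[ n ] pentSum n
block≈pentSum zero    m _   = refl
block≈pentSum (suc n) m m≤n = begin
  block 0 (suc n) m
    ≡⟨ sym (shift-by (block 0 (suc n)) (no-offset n) m) ⟩
  term 0 (suc n) m
    ≡⟨ sym (xor-identityʳ _) ⟩
  term 0 (suc n) m xor false
    ≡⟨ cong (term 0 (suc n) m xor_) (sym (telescope-beyond 0 n m m≤n)) ⟩
  telescope 0 (suc n) m
    ≡⟨ telescope≗pentSum (suc n) m ⟩
  pentSum (suc n) m
    ∎
  where
  open ≡-Reasoning
  no-offset : ∀ n → 0 * suc 0 + 2 * (0 + suc n) * 0 ≡ 0
  no-offset = solve-∀

pent⁺<pent⁻ : ∀ i → pent⁺ i < pent⁻ i
pent⁺<pent⁻ i = ≤-trans (m≤m+n (suc (pent⁺ i)) (suc (2 * i))) (≤-reflexive (gap i))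
  where
  gap : ∀ i → suc (suc i * (3 * i + 2)) + suc (2 * i) ≡ suc i * (3 * i + 4)
  gap = solve-∀

pent⁻<pent⁺ : ∀ i → pent⁻ i < pent⁺ (suc i)
pent⁻<pent⁺ i = ≤-trans (m≤m+n (suc (pent⁻ i)) (5 + 4 * i)) (≤-reflexive (gap i))
  where
  gap : ∀ i → suc (suc i * (3 * i + 4)) + (5 + 4 * i) ≡ suc (suc i) * (3 * suc i + 2)
  gap = solve-∀

pent⁺-mono : ∀ d j → pent⁺ j ≤ pent⁺ (d + j)
pent⁺-mono zero    j = ≤-refl
pent⁺-mono (suc d) j =
  ≤-trans (pent⁺-mono d j) (<⇒≤ (<-trans (pent⁺<pent⁻ (d + j)) (pent⁻<pent⁺ (d + j))))

i<pent⁺ : ∀ i → i < pent⁺ i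
i<pent⁺ i = ≤-trans (m≤m+n (suc i) (suc i * (3 * i + 1))) (≤-reflexive (split i))
  where
  split : ∀ i → suc i + suc i * (3 * i + 1) ≡ suc i * (3 * i + 2)
  split = solve-∀

pentSum-beyond : ∀ n m → pent⁺ n ≤ m → pentSum n m ≡ false
pentSum-beyond zero    (suc m) _  = refl
pentSum-beyond (suc n) m       le =
  cong₂ _xor_ (pentSum-beyond n m (<⇒≤ pent⁺<m))
              (cong₂ _xor_ (mono-off (pent⁺ n) m (≢-sym (<⇒≢ pent⁺<m)))
                           (mono-off (pent⁻ n) m (≢-sym (<⇒≢ pent⁻<m))))
  where
  pent⁻<m : pent⁻ n < m
  pent⁻<m = <-≤-trans (pent⁻<pent⁺ n) le
  pent⁺<m : pent⁺ n < m
  pent⁺<m = <-trans (pent⁺<pent⁻ n) pent⁻<m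

pentSum-stable : ∀ d j m → m < pent⁺ j → pentSum (d + j) m ≡ pentSum j m
pentSum-stable zero    j m m< = refl
pentSum-stable (suc d) j m m< =
  trans (cong₂ _xor_ (pentSum-stable d j m m<)
                     (cong₂ _xor_ (mono-off (pent⁺ (d + j)) m (<⇒≢ m<pent⁺))
                                  (mono-off (pent⁻ (d + j)) m (<⇒≢ (<-trans m<pent⁺ (pent⁺<pent⁻ (d + j)))))))
        (xor-identityʳ (pentSum j m))
  where
  m<pent⁺ : m < pent⁺ (d + j)
  m<pent⁺ = <-≤-trans m< (pent⁺-mono d j)

pentSum-pent⁺ : ∀ i n → i < n → pentSum n (pent⁺ i) ≡ true
pentSum-pent⁺ i n i<n = begin
  pentSum n (pent⁺ i)
    ≡⟨ cong (λ z → pentSum z (pent⁺ i)) (sym (m∸n+n≡m i<n)) ⟩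
  pentSum (n ∸ suc i + suc i) (pent⁺ i)
    ≡⟨ pentSum-stable (n ∸ suc i) (suc i) (pent⁺ i) (<-trans (pent⁺<pent⁻ i) (pent⁻<pent⁺ i)) ⟩
  pentSum i (pent⁺ i) xor (mono (pent⁺ i) (pent⁺ i) xor mono (pent⁻ i) (pent⁺ i))
    ≡⟨ cong₂ _xor_ (pentSum-beyond i (pent⁺ i) ≤-refl)
                   (cong₂ _xor_ (mono-at (pent⁺ i)) (mono-off (pent⁻ i) (pent⁺ i) (<⇒≢ (pent⁺<pent⁻ i)))) ⟩
  true
    ∎
  where open ≡-Reasoning

pentSum-pent⁻ : ∀ i n → i < n → pentSum n (pent⁻ i) ≡ true
pentSum-pent⁻ i n i<n = begin
  pentSum n (pent⁻ i)
    ≡⟨ cong (λ z → pentSum z (pent⁻ i)) (sym (m∸n+n≡m i<n)) ⟩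
  pentSum (n ∸ suc i + suc i) (pent⁻ i)
    ≡⟨ pentSum-stable (n ∸ suc i) (suc i) (pent⁻ i) (pent⁻<pent⁺ i) ⟩
  pentSum i (pent⁻ i) xor (mono (pent⁺ i) (pent⁻ i) xor mono (pent⁻ i) (pent⁻ i))
    ≡⟨ cong₂ _xor_ (pentSum-beyond i (pent⁻ i) (<⇒≤ (pent⁺<pent⁻ i)))
                   (cong₂ _xor_ (mono-off (pent⁺ i) (pent⁻ i) (≢-sym (<⇒≢ (pent⁺<pent⁻ i)))) (mono-at (pent⁻ i))) ⟩
  true
    ∎
  where open ≡-Reasoning

Pentagonal : ℕ → Set
Pentagonal m = m ≡ 0 ⊎ ∃[ i ] (m ≡ pent⁺ i ⊎ m ≡ pent⁻ i)

pentSum-sound : ∀ n m → pentSum n m ≡ true → Pentagonal m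
pentSum-sound zero    zero eq = inj₁ refl
pentSum-sound (suc n) m    eq with xor-true (pentSum n m) (pentPair n m) eq
... | inj₁ eq′ = pentSum-sound n m eq′
... | inj₂ eq′ with xor-true (mono (pent⁺ n) m) (mono (pent⁻ n) m) eq′
...   | inj₁ at⁺ = inj₂ (n , inj₁ (mono-true (pent⁺ n) m at⁺))
...   | inj₂ at⁻ = inj₂ (n , inj₂ (mono-true (pent⁻ n) m at⁻))

pentSum-complete : ∀ m → 1 ≤ m → Pentagonal m → pentSum m m ≡ true
pentSum-complete m 1≤m (inj₁ refl)            = ⊥-elim (<-irrefl refl 1≤m)
pentSum-complete m 1≤m (inj₂ (i , inj₁ refl)) = pentSum-pent⁺ i m (i<pent⁺ i)
pentSum-complete m 1≤m (inj₂ (i , inj₂ refl)) = pentSum-pent⁻ i m (<-trans (i<pent⁺ i) (pent⁺<pent⁻ i))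

pos-cast : ∀ i c → + (suc i * (3 * i + c)) ≡ (+ 1 ℤ.+ + i) ℤ.* (+ 3 ℤ.* + i ℤ.+ + c)
pos-cast i c = trans (ℤ.pos-* (suc i) (3 * i + c))
                     (cong (+ suc i ℤ.*_) (trans (ℤ.pos-+ (3 * i) c) (cong (ℤ._+ + c) (ℤ.pos-* 3 i))))

pent⁺-ℤ : ∀ i → + suc i ℤ.* (+ 3 ℤ.* + suc i ℤ.- + 1) ≡ + pent⁺ i
pent⁺-ℤ i = trans (identity (+ i)) (sym (pos-cast i 2))
  where
  identity : ∀ j → (+ 1 ℤ.+ j) ℤ.* (+ 3 ℤ.* (+ 1 ℤ.+ j) ℤ.- + 1) ≡ (+ 1 ℤ.+ j) ℤ.* (+ 3 ℤ.* j ℤ.+ + 2)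
  identity = ℤSolver.solve-∀

pent⁻-ℤ : ∀ i → -[1+ i ] ℤ.* (+ 3 ℤ.* -[1+ i ] ℤ.- + 1) ≡ + pent⁻ i
pent⁻-ℤ i = trans (identity (+ i)) (sym (pos-cast i 4))
  where
  identity : ∀ j → ℤ.- (+ 1 ℤ.+ j) ℤ.* (+ 3 ℤ.* ℤ.- (+ 1 ℤ.+ j) ℤ.- + 1)
                   ≡ (+ 1 ℤ.+ j) ℤ.* (+ 3 ℤ.* j ℤ.+ + 4)
  identity = ℤSolver.solve-∀

pentagonal-from-ℤ : ∀ m → ∃[ k ] (+ m ≡ k ℤ.* (+ 3 ℤ.* k ℤ.- + 1)) → Pentagonal m
pentagonal-from-ℤ m (+ zero  , eq) = inj₁ (ℤ.+-injective eq)
pentagonal-from-ℤ m (+ suc i , eq) = inj₂ (i , inj₁ (ℤ.+-injective (trans eq (pent⁺-ℤ i))))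
pentagonal-from-ℤ m (-[1+ i ] , eq) = inj₂ (i , inj₂ (ℤ.+-injective (trans eq (pent⁻-ℤ i))))

pentagonal-to-ℤ : ∀ m → Pentagonal m → ∃[ k ] (+ m ≡ k ℤ.* (+ 3 ℤ.* k ℤ.- + 1))
pentagonal-to-ℤ m (inj₁ refl)            = + 0 , refl
pentagonal-to-ℤ m (inj₂ (i , inj₁ refl)) = + suc i , sym (pent⁺-ℤ i)
pentagonal-to-ℤ m (inj₂ (i , inj₂ refl)) = -[1+ i ] , sym (pent⁻-ℤ i)

xorSum : List Bool → Bool
xorSum []       = false
xorSum (b ∷ bs) = b xor xorSum bs

isOdd-length-concatMap : ∀ {A B : Set} (f : A → List B) xs →
  isOdd (length (concatMap f xs)) ≡ xorSum (map (isOdd ∘ length ∘ f) xs)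
isOdd-length-concatMap f []       = refl
isOdd-length-concatMap f (x ∷ xs) =
  trans (cong isOdd (length-++ (f x)))
        (trans (isOdd-+ (length (f x)) _) (cong (isOdd (length (f x)) xor_) (isOdd-length-concatMap f xs)))

xorSum-filter : ∀ (p h : ℕ → Bool) ms → xorSum (map h (filterᵇ p ms)) ≡ xorSum (map (λ m → p m ∧ h m) ms)
xorSum-filter p h []       = refl
xorSum-filter p h (m ∷ ms) with p m
... | true  = cong (h m xor_) (xorSum-filter p h ms)
... | false = xorSum-filter p h ms

xorSum-const : ∀ {A : Set} (xs : List A) b → xorSum (map (λ _ → b) xs) ≡ isOdd (length xs) ∧ b
xorSum-const []       b = refl
xorSum-const (x ∷ xs) b = begin
  b xor xorSum (map (λ _ → b) xs)  ≡⟨ cong (b xor_) (xorSum-const xs b) ⟩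
  b xor (isOdd (length xs) ∧ b)    ≡⟨ flip b (isOdd (length xs)) ⟩
  not (isOdd (length xs)) ∧ b      ≡⟨ cong (_∧ b) (sym (isOdd-suc (length xs))) ⟩
  isOdd (suc (length xs)) ∧ b      ∎
  where
  open ≡-Reasoning
  flip : ∀ b c → b xor (c ∧ b) ≡ not c ∧ b
  flip false false = refl
  flip false true  = refl
  flip true  false = refl
  flip true  true  = refl

xorUpTo : (ℕ → Bool) → ℕ → Bool
xorUpTo g zero    = false
xorUpTo g (suc F) = g 0 xor xorUpTo (g ∘ suc) F

xorSum-applyUpTo : ∀ (g : ℕ → Bool) f F → xorSum (map g (applyUpTo f F)) ≡ xorUpTo (g ∘ f) F
xorSum-applyUpTo g f zero    = refl
xorSum-applyUpTo g f (suc F) = cong (g (f 0) xor_) (xorSum-applyUpTo g (f ∘ suc) F)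

xorUpTo-cong : ∀ {g h} F → g ≗ h → xorUpTo g F ≡ xorUpTo h F
xorUpTo-cong zero    g≗h = refl
xorUpTo-cong (suc F) g≗h = cong₂ _xor_ (g≗h 0) (xorUpTo-cong F (g≗h ∘ suc))

xorUpTo-null : ∀ g F → (∀ m → g m ≡ false) → xorUpTo g F ≡ false
xorUpTo-null g zero    g=0 = refl
xorUpTo-null g (suc F) g=0 = cong₂ _xor_ (g=0 0) (xorUpTo-null (g ∘ suc) F (g=0 ∘ suc))

xorUpTo-+ : ∀ g a d → xorUpTo g (a + d) ≡ xorUpTo g a xor xorUpTo (λ m → g (a + m)) d
xorUpTo-+ g zero    d = refl
xorUpTo-+ g (suc a) d =
  trans (cong (g 0 xor_) (xorUpTo-+ (g ∘ suc) a d)) (sym (xor-assoc (g 0) _ _))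

parityC : ℕ → Series
parityC s n = isOdd (length (ops s n))

fits : ℕ → ℕ → ℕ → Bool
fits x n m = ⌊ m * x ≤? n ⌋

fits-false : ∀ x n m → n < m * x → fits x n m ≡ false
fits-false x n m n<mx = trans (isYes≗does (m * x ≤? n)) (dec-false (m * x ≤? n) (<⇒≱ n<mx))

fits-shift : ∀ x r m → fits x (x + r) (suc m) ≡ fits x r m
fits-shift x r m =
  trans (isYes≗does (x + m * x ≤? x + r))
        (trans (does-⇔ (mk⇔ (+-cancelˡ-≤ x (m * x) r) (+-monoʳ-≤ x)) (x + m * x ≤? x + r) (m * x ≤? r))
               (sym (isYes≗does (m * x ≤? r))))

-- geometric x g = g / (1 + q^x), expanded as the coefficientwise sum Σ_{m x ≤ n} g(n - m x).
geometric : ℕ → Series → Series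
geometric x g n = xorUpTo (λ m → fits x n m ∧ g (n ∸ m * x)) (suc n)

geometric-below : ∀ x g n → n < x → geometric x g n ≡ g n
geometric-below x g n n<x =
  trans (cong (g n xor_) (xorUpTo-null _ n
          (λ m → cong (_∧ g (n ∸ suc m * x)) (fits-false x n (suc m) (<-≤-trans n<x (m≤m+n x (m * x)))))))
        (xor-identityʳ (g n))

geometric-step : ∀ x′ g r → geometric (suc x′) g (suc x′ + r) ≡ g (suc x′ + r) xor geometric (suc x′) g r
geometric-step x′ g r = cong (g (x + r) xor_) (begin
  xorUpTo (λ m → fits x (x + r) (suc m) ∧ g (x + r ∸ suc m * x)) (x + r)
    ≡⟨ xorUpTo-cong (x + r) (λ m → cong₂ _∧_ (fits-shift x r m) (cong g ([m+n]∸[m+o]≡n∸o x r (m * x)))) ⟩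
  xorUpTo summand (x + r)
    ≡⟨ cong (xorUpTo summand) (trans (+-comm x r) (+-suc r x′)) ⟩
  xorUpTo summand (suc r + x′)
    ≡⟨ xorUpTo-+ summand (suc r) x′ ⟩
  geometric x g r xor xorUpTo (λ m → summand (suc r + m)) x′
    ≡⟨ cong (geometric x g r xor_) (xorUpTo-null (λ m → summand (suc r + m)) x′
                                           (λ m → cong (_∧ g (r ∸ (suc r + m) * x)) (fits-false x r (suc r + m) (too-many m)))) ⟩
  geometric x g r xor false
    ≡⟨ xor-identityʳ (geometric x g r) ⟩
  geometric x g r
    ∎)
  where
  open ≡-Reasoning
  x : ℕ
  x = suc x′
  summand : ℕ → Bool
  summand m = fits x r m ∧ g (r ∸ m * x)
  too-many : ∀ m → r < (suc r + m) * x
  too-many m = ≤-trans (m≤m+n (suc r) m) (m≤m*n (suc r + m) x)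

binom-geometric : ∀ x′ g → binom (suc x′) (geometric (suc x′) g) ≗ g
binom-geometric x′ g n with n <? suc x′
... | yes n<x = trans (cong₂ _xor_ (geometric-below (suc x′) g n n<x)
                                   (shift-below (suc x′) (geometric (suc x′) g) n n<x))
                      (xor-identityʳ (g n))
... | no n≮x with m≤n⇒∃[o]m+o≡n (≮⇒≥ n≮x)
...   | r , refl = trans (cong₂ _xor_ (geometric-step x′ g r) (shift-at (suc x′) (geometric (suc x′) g) r))
                         (xor-unpadʳ (g (suc x′ + r)) (geometric (suc x′) g r))

flags-odd : ∀ x → x % 2 ≡ 1 → flags x ≡ false ∷ true ∷ []
flags-odd x eq rewrite eq = refl

flags-even : ∀ x → x % 2 ≡ 0 → flags x ≡ false ∷ []
flags-even x eq rewrite eq = refl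

blocks-parity : ∀ x m → isOdd (length (blocks x (suc m))) ≡ not (isOdd x)
blocks-parity x m with isOdd x in odd
... | true  = trans (cong isOdd (length-map _ (flags x)))
                    (cong (isOdd ∘ length) (flags-odd x (trans (isOdd-%2 x) (cong bit odd))))
... | false = trans (cong isOdd (length-map _ (flags x)))
                    (cong (isOdd ∘ length) (flags-even x (trans (isOdd-%2 x) (cong bit odd))))

parityC-expand : ∀ s n r → suc s % 4 ≡ suc r →
  parityC (suc s) n ≡
  xorUpTo (λ m → fits (suc s) n m ∧ (isOdd (length (blocks (suc s) m)) ∧ parityC s (n ∸ m * suc s))) (suc n)
parityC-expand s n r eq rewrite eq =
  trans (isOdd-length-concatMap piece (filterᵇ (fits (suc s) n) (applyUpTo (λ m → m) (suc n))))
  (trans (xorSum-filter (fits (suc s) n) (isOdd ∘ length ∘ piece) (applyUpTo (λ m → m) (suc n)))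
  (trans (xorSum-applyUpTo (λ m → fits (suc s) n m ∧ isOdd (length (piece m))) (λ m → m) (suc n))
         (xorUpTo-cong (suc n) (λ m → cong (fits (suc s) n m ∧_) (piece-parity m)))))
  where
  piece : ℕ → List (List Part)
  piece m = concatMap (λ blk → map (blk ++_) (ops s (n ∸ m * suc s))) (blocks (suc s) m)
  piece-parity : ∀ m → isOdd (length (piece m)) ≡ isOdd (length (blocks (suc s) m)) ∧ parityC s (n ∸ m * suc s)
  piece-parity m =
    trans (isOdd-length-concatMap _ (blocks (suc s) m))
          (trans (cong xorSum (map-cong (λ blk → cong isOdd (length-map (blk ++_) (ops s (n ∸ m * suc s))))
                                        (blocks (suc s) m)))
                 (xorSum-const (blocks (suc s) m) (parityC s (n ∸ m * suc s))))

-- Odd parts do not change the parity: every positive multiplicity occurs twice.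
parityC-odd : ∀ s r → suc s % 4 ≡ suc r → isOdd (suc s) ≡ true → parityC (suc s) ≗ parityC s
parityC-odd s r e4 odd n =
  trans (parityC-expand s n r e4)
        (trans (cong (parityC s n xor_) (xorUpTo-null _ n vanish)) (xor-identityʳ (parityC s n)))
  where
  vanish : ∀ m → fits (suc s) n (suc m) ∧ (isOdd (length (blocks (suc s) (suc m))) ∧ parityC s (n ∸ suc m * suc s)) ≡ false
  vanish m = trans (cong (λ b → fits (suc s) n (suc m) ∧ (b ∧ parityC s (n ∸ suc m * suc s)))
                         (trans (blocks-parity (suc s) m) (cong not odd)))
                   (∧-zeroʳ (fits (suc s) n (suc m)))

-- A part size x ≡ 2 (mod 4) contributes the factor 1/(1 - q^x) ≡ 1/(1 + q^x).
parityC-twiceOdd : ∀ s → suc s % 4 ≡ 2 → isOdd (suc s) ≡ false → parityC (suc s) ≗ geometric (suc s) (parityC s)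
parityC-twiceOdd s e4 even n = trans (parityC-expand s n 1 e4) (xorUpTo-cong (suc n) one-block)
  where
  one-block : ∀ m → fits (suc s) n m ∧ (isOdd (length (blocks (suc s) m)) ∧ parityC s (n ∸ m * suc s))
                    ≡ fits (suc s) n m ∧ parityC s (n ∸ m * suc s)
  one-block zero    = refl
  one-block (suc m) = cong (λ b → fits (suc s) n (suc m) ∧ (b ∧ parityC s (n ∸ suc m * suc s)))
                           (trans (blocks-parity (suc s) m) (cong not even))

parityC-multipleOf4 : ∀ s → suc s % 4 ≡ 0 → parityC (suc s) ≗ parityC s
parityC-multipleOf4 s eq n rewrite eq = refl

-- The three kinds of part sizes x, with the facts about x that the
-- factor bookkeeping needs (x = 2 ⌊x/2⌋ is ≡ 2 mod 4 iff ⌊x/2⌋ is odd).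
data PartKind (x : ℕ) : Set where
  multipleOf4 : x % 4 ≡ 0 → isOdd x ≡ false → isOdd ⌊ x /2⌋ ≡ false → PartKind x
  oddPart     : ∀ r → x % 4 ≡ suc r → isOdd x ≡ true → PartKind x
  twiceOdd    : x % 4 ≡ 2 → isOdd x ≡ false → isOdd ⌊ x /2⌋ ≡ true → PartKind x

partKind : ∀ x → PartKind x
partKind 0 = multipleOf4 refl refl refl
partKind 1 = oddPart 0 refl refl
partKind 2 = twiceOdd refl refl refl
partKind 3 = oddPart 2 refl refl
partKind (suc (suc (suc (suc k)))) with partKind k
... | multipleOf4 e4 eo eh = multipleOf4 (trans (%-period 4 k) e4) eo eh
... | oddPart r e4 eo      = oddPart r (trans (%-period 4 k) e4) eo
... | twiceOdd e4 eo eh    = twiceOdd (trans (%-period 4 k) e4) eo eh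

-- Raising the largest allowed part from s to s + 1 leaves
-- ∏_{j ≤ ⌊s/2⌋ odd} (1 + q^{2j}) · Σ_n parityC s n q^n unchanged: the new part size
-- contributes a new factor of the product exactly when it is ≡ 2 (mod 4), and then the
-- two cancel.
parityC-inverse-step : ∀ s → prod 2 isOdd ⌊ suc s /2⌋ (parityC (suc s)) ≗ prod 2 isOdd ⌊ s /2⌋ (parityC s)
parityC-inverse-step s n with partKind (suc s)
... | oddPart r e4 eo = begin
  prod 2 isOdd ⌊ suc s /2⌋ (parityC (suc s)) n
    ≡⟨ cong (λ h → prod 2 isOdd h (parityC (suc s)) n) (half-odd s eo) ⟩
  prod 2 isOdd ⌊ s /2⌋ (parityC (suc s)) n
    ≡⟨ prod-cong 2 isOdd ⌊ s /2⌋ (parityC-odd s r e4 eo) n ⟩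
  prod 2 isOdd ⌊ s /2⌋ (parityC s) n
    ∎
  where open ≡-Reasoning
... | multipleOf4 e4 eo eh = begin
  prod 2 isOdd ⌊ suc s /2⌋ (parityC (suc s)) n
    ≡⟨ cong (λ h → prod 2 isOdd h (parityC (suc s)) n) h≡ ⟩
  prod 2 isOdd (suc ⌊ s /2⌋) (parityC (suc s)) n
    ≡⟨ cong (_$ n) (prod-skip 2 isOdd ⌊ s /2⌋ (parityC (suc s)) (subst (λ h → isOdd h ≡ false) h≡ eh)) ⟩
  prod 2 isOdd ⌊ s /2⌋ (parityC (suc s)) n
    ≡⟨ prod-cong 2 isOdd ⌊ s /2⌋ (parityC-multipleOf4 s e4) n ⟩
  prod 2 isOdd ⌊ s /2⌋ (parityC s) n
    ∎
  where
  open ≡-Reasoning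
  h≡ : ⌊ suc s /2⌋ ≡ suc ⌊ s /2⌋
  h≡ = proj₁ (half-even s eo)
... | twiceOdd e4 eo eh = begin
  prod 2 isOdd ⌊ suc s /2⌋ (parityC (suc s)) n
    ≡⟨ cong (λ h → prod 2 isOdd h (parityC (suc s)) n) h≡ ⟩
  prod 2 isOdd (suc ⌊ s /2⌋) (parityC (suc s)) n
    ≡⟨ cong (_$ n) (prod-take 2 isOdd ⌊ s /2⌋ (parityC (suc s)) (subst (λ h → isOdd h ≡ true) h≡ eh)) ⟩
  binom (2 * suc ⌊ s /2⌋) (prod 2 isOdd ⌊ s /2⌋ (parityC (suc s))) n
    ≡⟨ cong (λ x → binom x (prod 2 isOdd ⌊ s /2⌋ (parityC (suc s))) n) double ⟩
  binom (suc s) (prod 2 isOdd ⌊ s /2⌋ (parityC (suc s))) n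
    ≡⟨ binom-prod (suc s) 2 isOdd ⌊ s /2⌋ (parityC (suc s)) n ⟩
  prod 2 isOdd ⌊ s /2⌋ (binom (suc s) (parityC (suc s))) n
    ≡⟨ prod-cong 2 isOdd ⌊ s /2⌋ inverse n ⟩
  prod 2 isOdd ⌊ s /2⌋ (parityC s) n
    ∎
  where
  open ≡-Reasoning
  h≡ : ⌊ suc s /2⌋ ≡ suc ⌊ s /2⌋
  h≡ = proj₁ (half-even s eo)
  double : 2 * suc ⌊ s /2⌋ ≡ suc s
  double = trans (cong (λ z → suc ⌊ s /2⌋ + z) (+-identityʳ (suc ⌊ s /2⌋))) (sym (proj₂ (half-even s eo)))
  inverse : binom (suc s) (parityC (suc s)) ≗ parityC s
  inverse m = trans (binom-cong (suc s) (parityC-twiceOdd s e4 eo) m) (binom-geometric s (parityC s) m)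

parityC-inverse : ∀ s → prod 2 isOdd ⌊ s /2⌋ (parityC s) ≗ one
parityC-inverse zero    zero    = refl
parityC-inverse zero    (suc n) = refl
parityC-inverse (suc s) n       = trans (parityC-inverse-step s n) (parityC-inverse s n)

-- The fuel bound for odd-times-every: scale 2 doubled n times exceeds n.
n<2^n*2 : ∀ n → n < 2 ^ n * 2
n<2^n*2 zero    = s≤s z≤n
n<2^n*2 (suc n) =
  ≤-trans (s≤s (n<2^n*2 n))
          (≤-trans (+-monoˡ-≤ (2 ^ n * 2) (≤-trans (s≤s z≤n) (n<2^n*2 n))) (≤-reflexive (double (2 ^ n))))
  where
  double : ∀ a → a * 2 + a * 2 ≡ (2 * a) * 2
  double = solve-∀

parityC≈pentSum : ∀ n → parityC n ≈[ n ] pentSum n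
parityC≈pentSum n = ≈-trans (prod-cancel 1 isOdd h n same-inverse) euler-product
  where
  h : ℕ
  h = ⌊ n /2⌋
  n<2[1+h] : n < 2 * suc h
  n<2[1+h] = ≤-trans (s≤s (half-bound n)) (≤-reflexive (double h))
    where
    double : ∀ h → suc (suc (h + h)) ≡ 2 * suc h
    double = solve-∀
  -- (b), where the odd factors of degree > n may be dropped.
  odd-inverse : prod 2 isOdd h (prod 2 every n one) ≈[ n ] one
  odd-inverse =
    ≈-trans (≈-sym (prod-trim 2 isOdd n (prod 2 every n one) (⌊n/2⌋≤n n) n<2[1+h]))
            (odd-times-every n 2 n n (n<2^n*2 n) (m≤m+n (suc n) (1 * suc n)))
  same-inverse : prod 2 isOdd h (parityC n) ≈[ n ] prod 2 isOdd h (prod 2 every n one)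
  same-inverse = ≈-trans (≗⇒≈ n (parityC-inverse n)) (≈-sym odd-inverse)
  euler-product : prod 2 every n one ≈[ n ] pentSum n
  euler-product = ≈-trans (≗⇒≈ n (λ m → sym (block-prod n m))) (block≈pentSum n)

C41-parity : ∀ n → C41 n % 2 ≡ bit (pentSum n n)
C41-parity n = trans (isOdd-%2 (C41 n)) (cong bit (parityC≈pentSum n n ≤-refl))

mainTheorem10 : (n : ℕ) → 1 ≤ n →
    ((∃[ k ] (+ n ≡ k ℤ.* (+ 3 ℤ.* k ℤ.- + 1))) → C41 n % 2 ≡ 1)
    × ((¬ (∃[ k ] (+ n ≡ k ℤ.* (+ 3 ℤ.* k ℤ.- + 1)))) → C41 n % 2 ≡ 0)
mainTheorem10 n 1≤n = pentagonal , non-pentagonal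
  where
  pentagonal : ∃[ k ] (+ n ≡ k ℤ.* (+ 3 ℤ.* k ℤ.- + 1)) → C41 n % 2 ≡ 1
  pentagonal k = trans (C41-parity n) (cong bit (pentSum-complete n 1≤n (pentagonal-from-ℤ n k)))
  non-pentagonal : ¬ (∃[ k ] (+ n ≡ k ℤ.* (+ 3 ℤ.* k ℤ.- + 1))) → C41 n % 2 ≡ 0
  non-pentagonal ¬k = trans (C41-parity n)
    (cong bit (¬-not (λ coeff → ¬k (pentagonal-to-ℤ n (pentSum-sound n n coeff)))))
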